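{- Let $n\ge 3$. For any $K\subseteq\{2,\ldots,n-1\}$ the domain $F_K$ is copious, i.e. for every three distinct alternatives $a,b,c\in[n]$ the restriction of $F_K$ to $\{a,b,c\}$ consists of exactly four distinct linear orders.
   Context: $[n]=\{1,\ldots,n\}$. The generalised Fishburn domain $F_K$ is the set of all linear orders $v$ on $[n]$ such that for all $1\le i<j<k\le n$: if $j\in K$ then $j$ is not ranked last by $v$ among $\{i,j,k\}$, and if $j\notin K$ then $j$ is not ranked first by $v$ among $\{i,j,k\}$. The restriction of a set of linear orders to $\{a,b,c\}$ is the set of induced linear orders on $\{a,b,c\}$. -}

module Defs where

open import Data.Nat using (ℕ; _≥_; suc)
open import Data.Fin using (Fin; toℕ; _<_)
open import Data.Fin.Subset using (Subset; _∈_; _∉_)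
open import Data.Product using (_×_; Σ; ∃; _,_)
open import Data.Sum using (_⊎_)
open import Relation.Nullary using (¬_)
open import Relation.Binary.PropositionalEquality using (_≡_)
open import Function.Definitions using (Injective)
open import Function.Bundles using (_⇔_)

-- Alternatives [n] = {1,…,n} are represented by Fin n (index i ↔ alternative i+1).
-- A linear order on [n] is given by an injective rank function; x is ranked above
-- (preferred to) y iff rank x < rank y.
record LinOrder (n : ℕ) : Set where
  field
    rank  : Fin n → Fin n
    rank-injective : Injective _≡_ _≡_ rank
open LinOrder public

_⊢_≻_ : ∀ {n} → LinOrder n → Fin n → Fin n → Set
v ⊢ x ≻ y = rank v x < rank v y

LastAmong : ∀ {n} → LinOrder n → Fin n → Fin n → Fin n → Set
LastAmong v j i k = (v ⊢ i ≻ j) × (v ⊢ k ≻ j)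

FirstAmong : ∀ {n} → LinOrder n → Fin n → Fin n → Fin n → Set
FirstAmong v j i k = (v ⊢ j ≻ i) × (v ⊢ j ≻ k)

InFishburn : ∀ {n} → Subset n → LinOrder n → Set
InFishburn {n} K v = ∀ (i j k : Fin n) → i < j → j < k →
  (j ∈ K → ¬ LastAmong v j i k) × (j ∉ K → ¬ FirstAmong v j i k)

InTriple : ∀ {n} → Fin n → Fin n → Fin n → Fin n → Set
InTriple a b c x = (x ≡ a) ⊎ (x ≡ b) ⊎ (x ≡ c)

SameRestriction : ∀ {n} → Fin n → Fin n → Fin n → LinOrder n → LinOrder n → Set
SameRestriction a b c v w = ∀ x y → InTriple a b c x → InTriple a b c y →
  (v ⊢ x ≻ y) ⇔ (w ⊢ x ≻ y)

RestrictionHasFour : ∀ {n} → Subset n → Fin n → Fin n → Fin n → Set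
RestrictionHasFour K a b c =
  Σ (LinOrder _) λ v₁ → Σ (LinOrder _) λ v₂ → Σ (LinOrder _) λ v₃ → Σ (LinOrder _) λ v₄ →
    (InFishburn K v₁ × InFishburn K v₂ × InFishburn K v₃ × InFishburn K v₄)
  × (¬ R v₁ v₂ × ¬ R v₁ v₃ × ¬ R v₁ v₄ × ¬ R v₂ v₃ × ¬ R v₂ v₄ × ¬ R v₃ v₄)
  × (∀ v → InFishburn K v → R v v₁ ⊎ R v v₂ ⊎ R v v₃ ⊎ R v v₄)
  where R = SameRestriction a b c

Copious : ∀ {n} → Subset n → Set
Copious {n} K = ∀ (a b c : Fin n) → ¬ a ≡ b → ¬ b ≡ c → ¬ a ≡ c →
  RestrictionHasFour K a b c

-- K ⊆ {2,…,n-1}, i.e. in 0-based indices K contains neither 0 nor n-1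
KAdmissible : ∀ {n} → Subset n → Set
KAdmissible {n} K = ∀ (x : Fin n) → x ∈ K → (¬ toℕ x ≡ 0) × (¬ suc (toℕ x) ≡ n)

{-# OPTIONS --safe #-}
-- For u < v < w the defining condition of F_K, applied to (u, v, w) itself, excludes the
-- two orders of {u, v, w} with v last (v ∈ K) or v first (v ∉ K), leaving at most four.
-- All four occur: the index order and its reverse lie in every F_K, and two "pivot"
-- orders centred at v supply v ≻ u ≻ w and v ≻ w ≻ u (resp. u ≻ w ≻ v and w ≻ u ≻ v).
-- An arbitrary triple is reduced to a sorted one, since the claim depends only on the set.
module Submission where

open import Defs
open import Level using (0ℓ)
open import Data.Bool using (Bool; true; false; if_then_else_)
open import Data.Empty using (⊥-elim)
open import Data.Fin as Fin using (Fin; toℕ; fromℕ<)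
import Data.Fin.Properties as Finₚ
open import Data.Fin.Subset using (Subset; _∈_; _∉_; _⊂_; ∣_∣)
open import Data.Fin.Subset.Properties using (_∈?_; ∈⊤; ∣⊤∣≡n; p⊂q⇒∣p∣<∣q∣)
open import Data.Nat using (ℕ; _≥_; suc; _+_; _∸_; _≤_; _<_; z≤n; s≤s; s<s)
open import Data.Nat.Properties
open import Data.Product using (_×_; _,_; ∃; proj₁; proj₂)
open import Data.Product.Relation.Binary.Lex.Strict using (×-Lex; ×-transitive; ×-compare)
open import Data.Sum using (_⊎_; inj₁; inj₂; [_,_])
import Data.Sum as Sum
open import Data.Vec using (tabulate)
open import Data.Vec.Properties using (lookup∘tabulate; lookup⇒[]=; []=⇒lookup)
open import Function using (_on_; case_of_; id; const; _∘_)
open import Function.Bundles using (_⇔_; mk⇔; Equivalence)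
open import Relation.Binary using (Rel; Transitive; Trichotomous; tri<; tri≈; tri>)
open import Relation.Binary.Consequences using (tri⇒irr; tri⇒dec<)
open import Relation.Binary.PropositionalEquality
  using (_≡_; _≢_; ≢-sym; refl; sym; trans; cong; cong₂; subst; subst₂; isEquivalence; resp₂)
open import Relation.Nullary using (¬_; Dec; yes; no; does; contradiction)
open import Relation.Nullary.Decidable using (dec-true; dec-false; does-⇔)

does≡⇒⇔ : ∀ {A B : Set} (a? : Dec A) (b? : Dec B) → does a? ≡ does b? → A ⇔ B
does≡⇒⇔ (yes a) (yes b) _ = mk⇔ (const b) (const a)
does≡⇒⇔ (no ¬a) (no ¬b) _ = mk⇔ (⊥-elim ∘ ¬a) (⊥-elim ∘ ¬b)

module _ {n : ℕ} (o : LinOrder n) where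

  ≻-irrefl : ∀ {x} → ¬ o ⊢ x ≻ x
  ≻-irrefl = Finₚ.<-irrefl refl

  ≻-asym : ∀ {x y} → o ⊢ x ≻ y → ¬ o ⊢ y ≻ x
  ≻-asym = Finₚ.<-asym

  ≻-trans : ∀ {x y z} → o ⊢ x ≻ y → o ⊢ y ≻ z → o ⊢ x ≻ z
  ≻-trans = Finₚ.<-trans

  ≻-dec : ∀ x y → Dec (o ⊢ x ≻ y)
  ≻-dec x y = rank o x Finₚ.<? rank o y

  ≻-connex : ∀ {x y} → x ≢ y → o ⊢ x ≻ y ⊎ o ⊢ y ≻ x
  ≻-connex {x} {y} x≢y with Finₚ.<-cmp (rank o x) (rank o y)
  ... | tri< x≻y _ _ = inj₁ x≻y
  ... | tri≈ _ e _   = contradiction (rank-injective o e) x≢y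
  ... | tri> _ _ y≻x = inj₂ y≻x

  ≻-flip : ∀ {x y} → x ≢ y → ¬ o ⊢ x ≻ y → o ⊢ y ≻ x
  ≻-flip x≢y x⊁y = [ ⊥-elim ∘ x⊁y , id ] (≻-connex x≢y)

  data Oriented (x y : Fin n) : Bool → Set where
    forward  : o ⊢ x ≻ y → Oriented x y true
    backward : o ⊢ y ≻ x → Oriented x y false

  orientation : ∀ {x y} → x ≢ y → ∃ (Oriented x y)
  orientation x≢y = [ (λ x≻y → true , forward x≻y) , (λ y≻x → false , backward y≻x) ] (≻-connex x≢y)

  does-≻-dec : ∀ {x y β} → Oriented x y β → does (≻-dec x y) ≡ β
  does-≻-dec {x} {y} (forward x≻y)  = dec-true (≻-dec x y) x≻y
  does-≻-dec {x} {y} (backward y≻x) = dec-false (≻-dec x y) (≻-asym y≻x)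

module Ranking {n : ℕ} {_⊏_ : Rel (Fin n) 0ℓ}
  (⊏-trans : Transitive _⊏_) (⊏-cmp : Trichotomous _≡_ _⊏_) where

  below : Fin n → Subset n
  below x = tabulate (λ y → does (tri⇒dec< ⊏-cmp y x))

  ∈-below⁺ : ∀ {x y} → y ⊏ x → y ∈ below x
  ∈-below⁺ {x} {y} y⊏x =
    lookup⇒[]= y _ (trans (lookup∘tabulate _ y) (dec-true (tri⇒dec< ⊏-cmp y x) y⊏x))

  ∈-below⁻ : ∀ {x y} → y ∈ below x → y ⊏ x
  ∈-below⁻ {x} {y} y∈ with tri⇒dec< ⊏-cmp y x | trans (sym (lookup∘tabulate _ y)) ([]=⇒lookup y∈)
  ... | yes y⊏x | _  = y⊏x
  ... | no _    | ()

  ∉-below : ∀ x → x ∉ below x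
  ∉-below x x∈ = tri⇒irr ⊏-cmp refl (∈-below⁻ x∈)

  below-⊂ : ∀ {x y} → x ⊏ y → below x ⊂ below y
  below-⊂ {x} x⊏y = (λ z∈ → ∈-below⁺ (⊏-trans (∈-below⁻ z∈) x⊏y)) , x , ∈-below⁺ x⊏y , ∉-below x

  ∣below∣<n : ∀ x → ∣ below x ∣ < n
  ∣below∣<n x = subst (∣ below x ∣ <_) (∣⊤∣≡n n) (p⊂q⇒∣p∣<∣q∣ ((λ _ → ∈⊤) , x , ∈⊤ , ∉-below x))

  position : Fin n → Fin n
  position x = fromℕ< (∣below∣<n x)

  ⊏⇒position< : ∀ {x y} → x ⊏ y → position x Fin.< position y
  ⊏⇒position< {x} {y} x⊏y =
    subst₂ _<_ (sym (Finₚ.toℕ-fromℕ< (∣below∣<n x))) (sym (Finₚ.toℕ-fromℕ< (∣below∣<n y)))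
      (p⊂q⇒∣p∣<∣q∣ (below-⊂ x⊏y))

  position-injective : ∀ {x y} → position x ≡ position y → x ≡ y
  position-injective {x} {y} e with ⊏-cmp x y
  ... | tri< x⊏y _ _ = contradiction e (Finₚ.<⇒≢ (⊏⇒position< x⊏y))
  ... | tri≈ _ x≡y _ = x≡y
  ... | tri> _ _ y⊏x = contradiction (sym e) (Finₚ.<⇒≢ (⊏⇒position< y⊏x))

  linOrder : LinOrder n
  linOrder = record { rank = position ; rank-injective = position-injective }

module KeyOrder {n : ℕ} (key : Fin n → ℕ) where

  _⊏_ : Rel (Fin n) 0ℓ
  _⊏_ = ×-Lex _≡_ _<_ Fin._<_ on (λ x → key x , x)

  ⊏-trans : Transitive _⊏_
  ⊏-trans = ×-transitive {_<₂_ = Fin._<_} isEquivalence (resp₂ _<_) <-trans Finₚ.<-trans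

  ⊏-cmp : Trichotomous _≡_ _⊏_
  ⊏-cmp x y with ×-compare sym <-cmp Finₚ.<-cmp (key x , x) (key y , y)
  ... | tri< x⊏y x≉y y⋢x         = tri< x⊏y (λ { refl → x≉y (refl , refl) }) y⋢x
  ... | tri≈ x⋢y (_ , x≡y) y⋢x = tri≈ x⋢y x≡y y⋢x
  ... | tri> x⋢y x≉y y⊏x         = tri> x⋢y (λ { refl → x≉y (refl , refl) }) y⊏x

  keyOrder : LinOrder n
  keyOrder = Ranking.linOrder ⊏-trans ⊏-cmp

  key<⇒≻ : ∀ {x y} → key x < key y → keyOrder ⊢ x ≻ y
  key<⇒≻ k< = Ranking.⊏⇒position< ⊏-trans ⊏-cmp (inj₁ k<)

  index<⇒≻ : ∀ {x y} → key x ≡ key y → x Fin.< y → keyOrder ⊢ x ≻ y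
  index<⇒≻ k≡ x<y = Ranking.⊏⇒position< ⊏-trans ⊏-cmp (inj₂ (k≡ , x<y))

inFishburn-intro : ∀ {n} {K : Subset n} {o : LinOrder n} →
  (∀ {i j k} → i Fin.< j → j Fin.< k → j ∈ K → o ⊢ j ≻ i ⊎ o ⊢ j ≻ k) →
  (∀ {i j k} → i Fin.< j → j Fin.< k → j ∉ K → o ⊢ i ≻ j ⊎ o ⊢ k ≻ j) →
  InFishburn K o
inFishburn-intro {o = o} notLast notFirst i j k i<j j<k =
  (λ j∈K (i≻j , k≻j) → [ ≻-asym o i≻j , ≻-asym o k≻j ] (notLast i<j j<k j∈K)) ,
  (λ j∉K (j≻i , j≻k) → [ ≻-asym o j≻i , ≻-asym o j≻k ] (notFirst i<j j<k j∉K))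

module _ {n : ℕ} where

  indexOrder : LinOrder n
  indexOrder = KeyOrder.keyOrder (λ _ → 0)

  indexOrder-≻ : ∀ {x y} → x Fin.< y → indexOrder ⊢ x ≻ y
  indexOrder-≻ = KeyOrder.index<⇒≻ (λ _ → 0) refl

  indexOrder-inFishburn : (K : Subset n) → InFishburn K indexOrder
  indexOrder-inFishburn K = inFishburn-intro {K = K} {indexOrder}
    (λ _ j<k _ → inj₂ (indexOrder-≻ j<k)) (λ i<j _ _ → inj₁ (indexOrder-≻ i<j))

  reverseOrder : LinOrder n
  reverseOrder = KeyOrder.keyOrder (λ x → n ∸ toℕ x)

  reverseOrder-≻ : ∀ {x y} → x Fin.< y → reverseOrder ⊢ y ≻ x
  reverseOrder-≻ {y = y} x<y =
    KeyOrder.key<⇒≻ (λ x → n ∸ toℕ x) (∸-monoʳ-< x<y (<⇒≤ (Finₚ.toℕ<n y)))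

  reverseOrder-inFishburn : (K : Subset n) → InFishburn K reverseOrder
  reverseOrder-inFishburn K = inFishburn-intro {K = K} {reverseOrder}
    (λ i<j _ _ → inj₁ (reverseOrder-≻ i<j)) (λ _ j<k _ → inj₂ (reverseOrder-≻ j<k))

-- pivotOrder b ranks p first if p ∈ K and last otherwise; in between come the two sides
-- of p, the left one first iff b. Each side lists its members of K from nearest to farthest
-- from p, then its other elements from farthest to nearest, so that of i < j < k with j ≠ p,
-- the middle j beats (j ∈ K) or loses to (j ∉ K) whichever of i, k lies on its side.
module Pivot {n : ℕ} (K : Subset n) (p : Fin n) where

  sideKey : Fin n → ℕ → ℕ
  sideKey x d = if does (x ∈? K) then d else n + (n ∸ d)

  sideKey-∈K : ∀ {i j d d′} → j ∈ K → d < d′ → d′ ≤ n → sideKey j d < sideKey i d′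
  sideKey-∈K {i} {j} j∈K d<d′ d′≤n with j ∈? K | i ∈? K
  ... | no j∉K | _     = contradiction j∈K j∉K
  ... | yes _  | yes _ = d<d′
  ... | yes _  | no _  = <-≤-trans (<-≤-trans d<d′ d′≤n) (m≤m+n n _)

  sideKey-∉K : ∀ {i j d d′} → j ∉ K → d < d′ → d′ ≤ n → sideKey i d′ < sideKey j d
  sideKey-∉K {i} {j} j∉K d<d′ d′≤n with j ∈? K | i ∈? K
  ... | yes j∈K | _     = contradiction j∈K j∉K
  ... | no _    | yes _ = ≤-<-trans d′≤n (m<m+n n (m<n⇒0<n∸m (<-≤-trans d<d′ d′≤n)))
  ... | no _    | no _  = +-monoʳ-< n (∸-monoʳ-< d<d′ d′≤n)

  S : ℕ
  S = suc (n + n)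

  sideKey<S : ∀ x {d} → d ≤ n → sideKey x d < S
  sideKey<S x {d} d≤n with x ∈? K
  ... | yes _ = s≤s (≤-trans d≤n (m≤m+n n n))
  ... | no _  = s≤s (+-monoʳ-≤ n (m∸n≤m n d))

  leftDist rightDist : Fin n → ℕ
  leftDist x = toℕ p ∸ toℕ x
  rightDist x = toℕ x ∸ toℕ p

  leftDist≤n : ∀ x → leftDist x ≤ n
  leftDist≤n x = ≤-trans (m∸n≤m (toℕ p) (toℕ x)) (<⇒≤ (Finₚ.toℕ<n p))

  rightDist≤n : ∀ x → rightDist x ≤ n
  rightDist≤n x = ≤-trans (m∸n≤m (toℕ x) (toℕ p)) (<⇒≤ (Finₚ.toℕ<n x))

  leftDist-< : ∀ {i j} → i Fin.< j → j Fin.< p → leftDist j < leftDist i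
  leftDist-< i<j j<p = ∸-monoʳ-< i<j (<⇒≤ j<p)

  rightDist-< : ∀ {j k} → p Fin.< j → j Fin.< k → rightDist j < rightDist k
  rightDist-< p<j j<k = ∸-monoˡ-< j<k (<⇒≤ p<j)

  leftOffset rightOffset : Bool → ℕ
  leftOffset true = 0
  leftOffset false = S
  rightOffset true = S
  rightOffset false = 0

  leftOffset≤S : ∀ b → leftOffset b ≤ S
  leftOffset≤S true = z≤n
  leftOffset≤S false = ≤-refl

  rightOffset≤S : ∀ b → rightOffset b ≤ S
  rightOffset≤S true = ≤-refl
  rightOffset≤S false = z≤n

  pivotKey : Bool → Fin n → ℕ
  pivotKey b x with Finₚ.<-cmp x p
  ... | tri< _ _ _ = suc (leftOffset b + sideKey x (leftDist x))
  ... | tri≈ _ _ _ = if does (x ∈? K) then 0 else suc (S + S)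
  ... | tri> _ _ _ = suc (rightOffset b + sideKey x (rightDist x))

  module _ {b : Bool} where

    pivotKey-left : ∀ {x} → x Fin.< p → pivotKey b x ≡ suc (leftOffset b + sideKey x (leftDist x))
    pivotKey-left {x} x<p with Finₚ.<-cmp x p
    ... | tri< _ _ _   = refl
    ... | tri≈ x≮p _ _ = contradiction x<p x≮p
    ... | tri> x≮p _ _ = contradiction x<p x≮p

    pivotKey-right : ∀ {x} → p Fin.< x → pivotKey b x ≡ suc (rightOffset b + sideKey x (rightDist x))
    pivotKey-right {x} p<x with Finₚ.<-cmp x p
    ... | tri< _ _ p≮x = contradiction p<x p≮x
    ... | tri≈ _ _ p≮x = contradiction p<x p≮x
    ... | tri> _ _ _   = refl

    pivotKey-∈K : p ∈ K → pivotKey b p ≡ 0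
    pivotKey-∈K p∈K with Finₚ.<-cmp p p
    ... | tri< _ p≢p _ = contradiction refl p≢p
    ... | tri> _ p≢p _ = contradiction refl p≢p
    ... | tri≈ _ _ _ with p ∈? K
    ...   | yes _   = refl
    ...   | no p∉K = contradiction p∈K p∉K

    pivotKey-∉K : p ∉ K → pivotKey b p ≡ suc (S + S)
    pivotKey-∉K p∉K with Finₚ.<-cmp p p
    ... | tri< _ p≢p _ = contradiction refl p≢p
    ... | tri> _ p≢p _ = contradiction refl p≢p
    ... | tri≈ _ _ _ with p ∈? K
    ...   | yes p∈K = contradiction p∈K p∉K
    ...   | no _    = refl

    0<pivotKey : ∀ {x} → x ≢ p → 0 < pivotKey b x
    0<pivotKey {x} x≢p with Finₚ.<-cmp x p
    ... | tri< _ _ _   = s≤s z≤n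
    ... | tri≈ _ x≡p _ = contradiction x≡p x≢p
    ... | tri> _ _ _   = s≤s z≤n

    pivotKey<top : ∀ {x} → x ≢ p → pivotKey b x < suc (S + S)
    pivotKey<top {x} x≢p with Finₚ.<-cmp x p
    ... | tri< _ _ _   = s<s (+-mono-≤-< (leftOffset≤S b) (sideKey<S x (leftDist≤n x)))
    ... | tri≈ _ x≡p _ = contradiction x≡p x≢p
    ... | tri> _ _ _   = s<s (+-mono-≤-< (rightOffset≤S b) (sideKey<S x (rightDist≤n x)))

  pivotOrder : Bool → LinOrder n
  pivotOrder b = KeyOrder.keyOrder (pivotKey b)

  module _ {b : Bool} where

    ≻-left : ∀ {x y} → x Fin.< p → y Fin.< p →
             sideKey x (leftDist x) < sideKey y (leftDist y) → pivotOrder b ⊢ x ≻ y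
    ≻-left x<p y<p k< = KeyOrder.key<⇒≻ (pivotKey b)
      (subst₂ _<_ (sym (pivotKey-left x<p)) (sym (pivotKey-left y<p)) (s<s (+-monoʳ-< (leftOffset b) k<)))

    ≻-right : ∀ {x y} → p Fin.< x → p Fin.< y →
              sideKey x (rightDist x) < sideKey y (rightDist y) → pivotOrder b ⊢ x ≻ y
    ≻-right p<x p<y k< = KeyOrder.key<⇒≻ (pivotKey b)
      (subst₂ _<_ (sym (pivotKey-right p<x)) (sym (pivotKey-right p<y)) (s<s (+-monoʳ-< (rightOffset b) k<)))

    pivot-first : p ∈ K → ∀ {x} → x ≢ p → pivotOrder b ⊢ p ≻ x
    pivot-first p∈K {x} x≢p = KeyOrder.key<⇒≻ (pivotKey b)
      (subst (_< pivotKey b x) (sym (pivotKey-∈K p∈K)) (0<pivotKey x≢p))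

    pivot-last : p ∉ K → ∀ {x} → x ≢ p → pivotOrder b ⊢ x ≻ p
    pivot-last p∉K {x} x≢p = KeyOrder.key<⇒≻ (pivotKey b)
      (subst (pivotKey b x <_) (sym (pivotKey-∉K p∉K)) (pivotKey<top x≢p))

    pivotOrder-inFishburn : InFishburn K (pivotOrder b)
    pivotOrder-inFishburn = inFishburn-intro {K = K} {pivotOrder b} notLast notFirst
      where
      notLast : ∀ {i j k} → i Fin.< j → j Fin.< k → j ∈ K →
                pivotOrder b ⊢ j ≻ i ⊎ pivotOrder b ⊢ j ≻ k
      notLast {i} {j} {k} i<j j<k j∈K = case Finₚ.<-cmp j p of λ where
        (tri< j<p _ _)  → inj₁ (≻-left j<p (<-trans i<j j<p)
                              (sideKey-∈K {i} j∈K (leftDist-< i<j j<p) (leftDist≤n i)))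
        (tri≈ _ refl _) → inj₁ (pivot-first j∈K (Finₚ.<⇒≢ i<j))
        (tri> _ _ p<j)  → inj₂ (≻-right p<j (<-trans p<j j<k)
                              (sideKey-∈K {k} j∈K (rightDist-< p<j j<k) (rightDist≤n k)))

      notFirst : ∀ {i j k} → i Fin.< j → j Fin.< k → j ∉ K →
                 pivotOrder b ⊢ i ≻ j ⊎ pivotOrder b ⊢ k ≻ j
      notFirst {i} {j} {k} i<j j<k j∉K = case Finₚ.<-cmp j p of λ where
        (tri< j<p _ _)  → inj₁ (≻-left (<-trans i<j j<p) j<p
                              (sideKey-∉K {i} j∉K (leftDist-< i<j j<p) (leftDist≤n i)))
        (tri≈ _ refl _) → inj₁ (pivot-last j∉K (Finₚ.<⇒≢ i<j))
        (tri> _ _ p<j)  → inj₂ (≻-right (<-trans p<j j<k) p<j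
                              (sideKey-∉K {k} j∉K (rightDist-< p<j j<k) (rightDist≤n k)))

  leftFirst-≻ : ∀ {x y} → x Fin.< p → p Fin.< y → pivotOrder true ⊢ x ≻ y
  leftFirst-≻ {x} {y} x<p p<y = KeyOrder.key<⇒≻ (pivotKey true)
    (subst₂ _<_ (sym (pivotKey-left x<p)) (sym (pivotKey-right p<y))
      (s<s (<-≤-trans (sideKey<S x (leftDist≤n x)) (m≤m+n S _))))

  rightFirst-≻ : ∀ {x y} → x Fin.< p → p Fin.< y → pivotOrder false ⊢ y ≻ x
  rightFirst-≻ {x} {y} x<p p<y = KeyOrder.key<⇒≻ (pivotKey false)
    (subst₂ _<_ (sym (pivotKey-right p<y)) (sym (pivotKey-left x<p))
      (s<s (<-≤-trans (sideKey<S y (rightDist≤n y)) (m≤m+n S _))))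

-- For distinct u, v, w the profile determines the restriction to {u, v, w}, so
-- restrictions are told apart by comparing concrete Boolean triples.
module Profile {n : ℕ} (u v w : Fin n) where

  profile : LinOrder n → Bool × Bool × Bool
  profile o = does (≻-dec o u v) , does (≻-dec o u w) , does (≻-dec o v w)

  profile-≡ : ∀ o {β₁ β₂ β₃} → Oriented o u v β₁ → Oriented o u w β₂ → Oriented o v w β₃ →
              profile o ≡ (β₁ , β₂ , β₃)
  profile-≡ o uv uw vw = cong₂ _,_ (does-≻-dec o uv) (cong₂ _,_ (does-≻-dec o uw) (does-≻-dec o vw))

  sameRestriction⇒profile≡ : ∀ {o o′} → SameRestriction u v w o o′ → profile o ≡ profile o′
  sameRestriction⇒profile≡ {o} {o′} R =
    cong₂ _,_ (does-⇔ (R u v u∈ v∈) (≻-dec o u v) (≻-dec o′ u v))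
      (cong₂ _,_ (does-⇔ (R u w u∈ w∈) (≻-dec o u w) (≻-dec o′ u w))
                 (does-⇔ (R v w v∈ w∈) (≻-dec o v w) (≻-dec o′ v w)))
    where
    u∈ = inj₁ refl
    v∈ = inj₂ (inj₁ refl)
    w∈ = inj₂ (inj₂ refl)

  profile≡⇒sameRestriction : u ≢ v → u ≢ w → v ≢ w → ∀ {o o′} →
    profile o ≡ profile o′ → SameRestriction u v w o o′
  profile≡⇒sameRestriction u≢v u≢w v≢w {o} {o′} e = agree
    where
    uv = does≡⇒⇔ (≻-dec o u v) (≻-dec o′ u v) (cong proj₁ e)
    uw = does≡⇒⇔ (≻-dec o u w) (≻-dec o′ u w) (cong (proj₁ ∘ proj₂) e)
    vw = does≡⇒⇔ (≻-dec o v w) (≻-dec o′ v w) (cong (proj₂ ∘ proj₂) e)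

    diagonal : ∀ {x} → (o ⊢ x ≻ x) ⇔ (o′ ⊢ x ≻ x)
    diagonal = mk⇔ (⊥-elim ∘ ≻-irrefl o) (⊥-elim ∘ ≻-irrefl o′)

    flipped : ∀ {x y} → x ≢ y → (o ⊢ x ≻ y) ⇔ (o′ ⊢ x ≻ y) → (o ⊢ y ≻ x) ⇔ (o′ ⊢ y ≻ x)
    flipped x≢y xy = mk⇔
      (λ y≻x → ≻-flip o′ x≢y (≻-asym o y≻x ∘ Equivalence.from xy))
      (λ y≻x → ≻-flip o x≢y (≻-asym o′ y≻x ∘ Equivalence.to xy))

    agree : SameRestriction u v w o o′
    agree _ _ (inj₁ refl)        (inj₁ refl)        = diagonal
    agree _ _ (inj₁ refl)        (inj₂ (inj₁ refl)) = uv
    agree _ _ (inj₁ refl)        (inj₂ (inj₂ refl)) = uw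
    agree _ _ (inj₂ (inj₁ refl)) (inj₁ refl)        = flipped u≢v uv
    agree _ _ (inj₂ (inj₁ refl)) (inj₂ (inj₁ refl)) = diagonal
    agree _ _ (inj₂ (inj₁ refl)) (inj₂ (inj₂ refl)) = vw
    agree _ _ (inj₂ (inj₂ refl)) (inj₁ refl)        = flipped u≢w uw
    agree _ _ (inj₂ (inj₂ refl)) (inj₂ (inj₁ refl)) = flipped v≢w vw
    agree _ _ (inj₂ (inj₂ refl)) (inj₂ (inj₂ refl)) = diagonal

  restrictionHasFour-intro : ∀ {K : Subset n} → u ≢ v → u ≢ w → v ≢ w →
    ∀ {c₁ c₂ c₃ c₄} (o₁ o₂ o₃ o₄ : LinOrder n) →
    (∀ o → InFishburn K o → profile o ≡ c₁ ⊎ profile o ≡ c₂ ⊎ profile o ≡ c₃ ⊎ profile o ≡ c₄) →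
    InFishburn K o₁ × InFishburn K o₂ × InFishburn K o₃ × InFishburn K o₄ →
    profile o₁ ≡ c₁ → profile o₂ ≡ c₂ → profile o₃ ≡ c₃ → profile o₄ ≡ c₄ →
    c₁ ≢ c₂ × c₁ ≢ c₃ × c₁ ≢ c₄ × c₂ ≢ c₃ × c₂ ≢ c₄ × c₃ ≢ c₄ →
    RestrictionHasFour K u v w
  restrictionHasFour-intro u≢v u≢w v≢w o₁ o₂ o₃ o₄ cover fishburn e₁ e₂ e₃ e₄
    (c₁≢c₂ , c₁≢c₃ , c₁≢c₄ , c₂≢c₃ , c₂≢c₄ , c₃≢c₄) =
    o₁ , o₂ , o₃ , o₄ , fishburn ,
    (apart o₁ o₂ e₁ e₂ c₁≢c₂ , apart o₁ o₃ e₁ e₃ c₁≢c₃ , apart o₁ o₄ e₁ e₄ c₁≢c₄ ,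
     apart o₂ o₃ e₂ e₃ c₂≢c₃ , apart o₂ o₄ e₂ e₄ c₂≢c₄ , apart o₃ o₄ e₃ e₄ c₃≢c₄) ,
    λ o o∈F → Sum.map (agree o o₁ e₁)
                (Sum.map (agree o o₂ e₂) (Sum.map (agree o o₃ e₃) (agree o o₄ e₄))) (cover o o∈F)
    where
    apart : ∀ o o′ {c c′} → profile o ≡ c → profile o′ ≡ c′ → c ≢ c′ → ¬ SameRestriction u v w o o′
    apart o o′ e e′ c≢c′ R = c≢c′ (trans (sym e) (trans (sameRestriction⇒profile≡ {o} {o′} R) e′))

    agree : ∀ o o′ {c} → profile o′ ≡ c → profile o ≡ c → SameRestriction u v w o o′
    agree o o′ e′ e = profile≡⇒sameRestriction u≢v u≢w v≢w {o} {o′} (trans e (sym e′))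

module _ {n : ℕ} (K : Subset n) {u v w : Fin n} (u<v : u Fin.< v) (v<w : v Fin.< w) where

  open Profile u v w
  open Pivot K v

  private
    u≢v : u ≢ v
    u≢v = Finₚ.<⇒≢ u<v

    u<w : u Fin.< w
    u<w = Finₚ.<-trans u<v v<w

    u≢w : u ≢ w
    u≢w = Finₚ.<⇒≢ u<w

    v≢w : v ≢ w
    v≢w = Finₚ.<⇒≢ v<w

    w≢v : w ≢ v
    w≢v = ≢-sym v≢w

    fourInFishburn : InFishburn K indexOrder × InFishburn K reverseOrder ×
                     InFishburn K (pivotOrder true) × InFishburn K (pivotOrder false)
    fourInFishburn =
      indexOrder-inFishburn K , reverseOrder-inFishburn K , pivotOrder-inFishburn , pivotOrder-inFishburn

    indexOrder-profile : profile indexOrder ≡ (true , true , true)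
    indexOrder-profile = profile-≡ indexOrder
      (forward (indexOrder-≻ u<v)) (forward (indexOrder-≻ u<w)) (forward (indexOrder-≻ v<w))

    reverseOrder-profile : profile reverseOrder ≡ (false , false , false)
    reverseOrder-profile = profile-≡ reverseOrder
      (backward (reverseOrder-≻ u<v)) (backward (reverseOrder-≻ u<w)) (backward (reverseOrder-≻ v<w))

  profile-∈K : v ∈ K → ∀ o → InFishburn K o →
    profile o ≡ (true , true , true) ⊎ profile o ≡ (false , false , false) ⊎
    profile o ≡ (false , true , true) ⊎ profile o ≡ (false , false , true)
  profile-∈K v∈K o o∈F with orientation o u≢v | orientation o u≢w | orientation o v≢w
  ... | _ , uv@(forward _)  | _ , uw@(forward _)  | _ , vw@(forward _)  =
    inj₁ (profile-≡ o uv uw vw)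
  ... | _ , uv@(backward _) | _ , uw@(backward _) | _ , vw@(backward _) =
    inj₂ (inj₁ (profile-≡ o uv uw vw))
  ... | _ , uv@(backward _) | _ , uw@(forward _)  | _ , vw@(forward _)  =
    inj₂ (inj₂ (inj₁ (profile-≡ o uv uw vw)))
  ... | _ , uv@(backward _) | _ , uw@(backward _) | _ , vw@(forward _)  =
    inj₂ (inj₂ (inj₂ (profile-≡ o uv uw vw)))
  ... | _ , forward u≻v  | _ , backward w≻u | _ , forward v≻w  =
    ⊥-elim (≻-asym o (≻-trans o u≻v v≻w) w≻u)
  ... | _ , backward v≻u | _ , forward u≻w  | _ , backward w≻v =
    ⊥-elim (≻-asym o (≻-trans o v≻u u≻w) w≻v)
  ... | _ , forward u≻v  | _                | _ , backward w≻v =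
    ⊥-elim (proj₁ (o∈F u v w u<v v<w) v∈K (u≻v , w≻v))

  profile-∉K : v ∉ K → ∀ o → InFishburn K o →
    profile o ≡ (true , true , true) ⊎ profile o ≡ (false , false , false) ⊎
    profile o ≡ (true , true , false) ⊎ profile o ≡ (true , false , false)
  profile-∉K v∉K o o∈F with orientation o u≢v | orientation o u≢w | orientation o v≢w
  ... | _ , uv@(forward _)  | _ , uw@(forward _)  | _ , vw@(forward _)  =
    inj₁ (profile-≡ o uv uw vw)
  ... | _ , uv@(backward _) | _ , uw@(backward _) | _ , vw@(backward _) =
    inj₂ (inj₁ (profile-≡ o uv uw vw))
  ... | _ , uv@(forward _)  | _ , uw@(forward _)  | _ , vw@(backward _) =
    inj₂ (inj₂ (inj₁ (profile-≡ o uv uw vw)))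
  ... | _ , uv@(forward _)  | _ , uw@(backward _) | _ , vw@(backward _) =
    inj₂ (inj₂ (inj₂ (profile-≡ o uv uw vw)))
  ... | _ , forward u≻v  | _ , backward w≻u | _ , forward v≻w  =
    ⊥-elim (≻-asym o (≻-trans o u≻v v≻w) w≻u)
  ... | _ , backward v≻u | _ , forward u≻w  | _ , backward w≻v =
    ⊥-elim (≻-asym o (≻-trans o v≻u u≻w) w≻v)
  ... | _ , backward v≻u | _                | _ , forward v≻w  =
    ⊥-elim (proj₂ (o∈F u v w u<v v<w) v∉K (v≻u , v≻w))

  restrictionHasFour-sorted : RestrictionHasFour K u v w
  restrictionHasFour-sorted with v ∈? K
  ... | yes v∈K = restrictionHasFour-intro u≢v u≢w v≢w
    indexOrder reverseOrder (pivotOrder true) (pivotOrder false) (profile-∈K v∈K)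
    fourInFishburn indexOrder-profile reverseOrder-profile
    (profile-≡ (pivotOrder true)
      (backward (pivot-first v∈K u≢v)) (forward (leftFirst-≻ u<v v<w)) (forward (pivot-first v∈K w≢v)))
    (profile-≡ (pivotOrder false)
      (backward (pivot-first v∈K u≢v)) (backward (rightFirst-≻ u<v v<w)) (forward (pivot-first v∈K w≢v)))
    ((λ ()) , (λ ()) , (λ ()) , (λ ()) , (λ ()) , (λ ()))
  ... | no v∉K = restrictionHasFour-intro u≢v u≢w v≢w
    indexOrder reverseOrder (pivotOrder true) (pivotOrder false) (profile-∉K v∉K)
    fourInFishburn indexOrder-profile reverseOrder-profile
    (profile-≡ (pivotOrder true)
      (forward (pivot-last v∉K u≢v)) (forward (leftFirst-≻ u<v v<w)) (backward (pivot-last v∉K w≢v)))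
    (profile-≡ (pivotOrder false)
      (forward (pivot-last v∉K u≢v)) (backward (rightFirst-≻ u<v v<w)) (backward (pivot-last v∉K w≢v)))
    ((λ ()) , (λ ()) , (λ ()) , (λ ()) , (λ ()) , (λ ()))

module _ {n : ℕ} {K : Subset n} {a b c a′ b′ c′ : Fin n}
  (⊆ : ∀ {x} → InTriple a b c x → InTriple a′ b′ c′ x)
  (⊇ : ∀ {x} → InTriple a′ b′ c′ x → InTriple a b c x) where

  restrictionHasFour-resp : RestrictionHasFour K a b c → RestrictionHasFour K a′ b′ c′
  restrictionHasFour-resp
    (o₁ , o₂ , o₃ , o₄ , fishburn , (d₁₂ , d₁₃ , d₁₄ , d₂₃ , d₂₄ , d₃₄) , cover) =
    o₁ , o₂ , o₃ , o₄ , fishburn ,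
    (d₁₂ ∘ widen o₁ o₂ , d₁₃ ∘ widen o₁ o₃ , d₁₄ ∘ widen o₁ o₄ ,
     d₂₃ ∘ widen o₂ o₃ , d₂₄ ∘ widen o₂ o₄ , d₃₄ ∘ widen o₃ o₄) ,
    λ o o∈F → Sum.map (narrow o o₁) (Sum.map (narrow o o₂) (Sum.map (narrow o o₃) (narrow o o₄)))
                      (cover o o∈F)
    where
    narrow : ∀ o o′ → SameRestriction a b c o o′ → SameRestriction a′ b′ c′ o o′
    narrow _ _ R x y x∈ y∈ = R x y (⊇ x∈) (⊇ y∈)

    widen : ∀ o o′ → SameRestriction a′ b′ c′ o o′ → SameRestriction a b c o o′
    widen _ _ R x y x∈ y∈ = R x y (⊆ x∈) (⊆ y∈)

module _ {n : ℕ} {K : Subset n} {a b c : Fin n} where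

  restrictionHasFour-swap₁₂ : RestrictionHasFour K a b c → RestrictionHasFour K b a c
  restrictionHasFour-swap₁₂ = restrictionHasFour-resp swap₁₂ swap₁₂
    where
    swap₁₂ : ∀ {a b c x : Fin n} → InTriple a b c x → InTriple b a c x
    swap₁₂ = [ inj₂ ∘ inj₁ , Sum.map₂ inj₂ ]

  restrictionHasFour-swap₂₃ : RestrictionHasFour K a b c → RestrictionHasFour K a c b
  restrictionHasFour-swap₂₃ = restrictionHasFour-resp swap₂₃ swap₂₃
    where
    swap₂₃ : ∀ {a b c x : Fin n} → InTriple a b c x → InTriple a c b x
    swap₂₃ = Sum.map₂ Sum.swap

module _ {n : ℕ} (P : Fin n → Fin n → Fin n → Set)
  (swap₁₂ : ∀ {a b c} → P a b c → P b a c) (swap₂₃ : ∀ {a b c} → P a b c → P a c b)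
  (sorted : ∀ {a b c} → a Fin.< b → b Fin.< c → P a b c) where

  wlog-sorted< : ∀ {a b c} → a Fin.< b → b ≢ c → a ≢ c → P a b c
  wlog-sorted< {a} {b} {c} a<b b≢c a≢c with Finₚ.<-cmp b c
  ... | tri< b<c _ _ = sorted a<b b<c
  ... | tri≈ _ b≡c _ = contradiction b≡c b≢c
  ... | tri> _ _ c<b with Finₚ.<-cmp a c
  ...   | tri< a<c _ _ = swap₂₃ (sorted a<c c<b)
  ...   | tri≈ _ a≡c _ = contradiction a≡c a≢c
  ...   | tri> _ _ c<a = swap₂₃ (swap₁₂ (sorted c<a a<b))

  wlog-sorted : ∀ {a b c} → a ≢ b → b ≢ c → a ≢ c → P a b c
  wlog-sorted {a} {b} a≢b b≢c a≢c with Finₚ.<-cmp a b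
  ... | tri< a<b _ _ = wlog-sorted< a<b b≢c a≢c
  ... | tri≈ _ a≡b _ = contradiction a≡b a≢b
  ... | tri> _ _ b<a = swap₁₂ (wlog-sorted< b<a a≢c b≢c)

lemma2 : (n : ℕ) → n ≥ 3 → (K : Subset n) → KAdmissible K → Copious K
lemma2 n _ K _ a b c = wlog-sorted (RestrictionHasFour K)
  restrictionHasFour-swap₁₂ restrictionHasFour-swap₂₃ (restrictionHasFour-sorted K)
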